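{- Let $G=(V,E)$ be a finite digraph with minimum out-degree at least $d$ and maximum in-degree $\delta\le \frac{2^{d-1}-e}{ed}$. Then for every pair of distinct vertices $v_1,v_2\in V$ there exists a friendly partition of $G$ which separates $v_1$ and $v_2$.
   Context: Digraphs have no loops and no parallel arcs in the same direction. A friendly partition of $G=(V,E)$ is a partition $\{V_1,V_2\}$ of $V$ into two nonempty sets such that every vertex has at least one out-neighbor in its own part; it separates $v_1,v_2$ if they lie in different parts. $e$ is Euler's number. -}

module Defs where

open import Data.Nat using (ℕ; zero; suc; _+_; _*_; _∸_; _^_; _≤_; _!)

open import Data.Bool using (Bool; true; false)
open import Data.Fin using (Fin)
open import Data.List using (length; filterᵇ; allFin)
open import Data.Product using (Σ; _×_)
open import Relation.Binary.PropositionalEquality using (_≡_; _≢_)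

-- A finite digraph on vertex set Fin n: arc relation as a Boolean matrix,
-- no loops (parallel arcs in the same direction are impossible by construction;
-- opposite arcs u→v and v→u are allowed).
record Digraph (n : ℕ) : Set where
  field
    arc   : Fin n → Fin n → Bool
    noLoop : ∀ v → arc v v ≡ false
open Digraph public

outdeg : ∀ {n} → Digraph n → Fin n → ℕ
outdeg {n} G v = length (filterᵇ (λ u → arc G v u) (allFin n))

indeg : ∀ {n} → Digraph n → Fin n → ℕ
indeg {n} G v = length (filterᵇ (λ u → arc G u v) (allFin n))

IsFriendly : ∀ {n} → Digraph n → (Fin n → Bool) → Set
IsFriendly {n} G part =
  Σ (Fin n) (λ a → part a ≡ true) ×
  Σ (Fin n) (λ b → part b ≡ false) ×
  (∀ v → Σ (Fin n) (λ u → arc G v u ≡ true × part u ≡ part v))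

Separates : ∀ {n} → (Fin n → Bool) → Fin n → Fin n → Set
Separates part v₁ v₂ = part v₁ ≢ part v₂

-- eSum k = Σ_{i=0}^{k} k!/i!   (so eSum k / k! is the k-th partial sum of
-- e = Σ 1/i!).  Recurrence: eSum (k+1) = (k+1) * eSum k + 1.
eSum : ℕ → ℕ
eSum zero = 1
eSum (suc k) = suc k * eSum k + 1

-- "e * m ≤ N" for naturals m, N: since e = sup_k Σ_{i≤k} 1/i!,
-- e*m ≤ N  iff  ∀ k, m * Σ_{i≤k} 1/i! ≤ N  iff  ∀ k, m * eSum k ≤ N * k!.
e*_≤_ : ℕ → ℕ → Set
e* m ≤ N = ∀ k → m * eSum k ≤ N * (k !)

-- Colour the vertices at random, with v₁ coloured true and v₂ false, and fix
-- for every vertex v a list L v of d of its out-neighbours. The colouring is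
-- friendly as soon as no vertex is lonely, i.e. coloured differently from all
-- of L v. At most one of v₁, v₂ can lie in L v (otherwise v cannot be lonely),
-- so lonely v has conditional probability at most 2^-(d-1); it is independent
-- of the events of all vertices w ∉ L v with L w ∩ L v = ∅, and the others are
-- at most dδ besides v, because every u ∈ L v has at most δ - 1 in-neighbours
-- other than v. The hypothesis e (dδ + 1) ≤ 2^(d-1) is the condition of the
-- symmetric Lovász Local Lemma, which is proved here by counting colourings.
module Submission where

open import Defs
open import Data.Nat using (ℕ; zero; suc; _+_; _*_; _∸_; _^_; _≤_; _<_; _!; z≤n; s≤s; z<s; s<s; >-nonZero; >-nonZero⁻¹)
open import Data.Nat.Properties hiding (_≟_)
open import Data.Nat.Induction using (<-wellFounded)
open import Data.Nat.Tactic.RingSolver using (solve-∀)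
open import Algebra.Bundles using (CommutativeMonoid)
import Algebra.Properties.CommutativeSemigroup +-commutativeSemigroup as +-Comm
import Algebra.Properties.CommutativeSemigroup *-commutativeSemigroup as *-Comm
open import Data.Bool using (Bool; true; false; not; _∧_; _∨_; _xor_)
open import Data.Bool.Properties
  using (∧-conicalˡ; ∧-conicalʳ; ∨-conicalˡ; ∨-conicalʳ; ∧-zeroʳ; ∨-zeroʳ; ∧-identityʳ; ∨-identityʳ;
         ∧-assoc; ∨-assoc; ∨-comm; ∧-commutativeMonoid; not-injective; not-distribˡ-xor)
import Algebra.Properties.CommutativeSemigroup (CommutativeMonoid.commutativeSemigroup ∧-commutativeMonoid) as ∧-Comm
open import Data.Bool.ListAction using (all; any)
open import Data.Fin using (Fin; zero; suc)
open import Data.Fin.Properties using (_≟_)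
import Data.Fin.Properties as Finₚ
open import Data.List using (List; []; _∷_; length; filterᵇ; take; allFin; tabulate)
open import Data.List.Properties using (length-take)
open import Data.Vec using (Vec; []; _∷_; lookup; updateAt) renaming (tabulate to tabulateᵛ)
open import Data.Vec.Properties using (lookup∘updateAt; lookup∘updateAt′; lookup∘tabulate)
open import Data.Product using (Σ; _,_; _×_; proj₁; proj₂)
open import Data.Unit using (⊤; tt)
open import Data.Empty using (⊥-elim)
open import Function.Base using (_∘_; id; case_of_)
open import Induction.WellFounded using (module All)
open import Relation.Binary.Construct.On using (wellFounded)
open import Relation.Binary.PropositionalEquality
open import Relation.Nullary using (yes; no; does)
open import Relation.Nullary.Decidable using (dec-true; dec-false)

-- Binomial estimate of (1 + 1/m)^m

sumBelow : ℕ → (ℕ → ℕ) → ℕ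
sumBelow zero    f = 0
sumBelow (suc N) f = f 0 + sumBelow N (f ∘ suc)

syntax sumBelow N (λ i → e) = ∑[ i < N ] e

sumBelow-cong : ∀ N {f g : ℕ → ℕ} → (∀ i → f i ≡ g i) → sumBelow N f ≡ sumBelow N g
sumBelow-cong zero    f≗g = refl
sumBelow-cong (suc N) f≗g = cong₂ _+_ (f≗g 0) (sumBelow-cong N (f≗g ∘ suc))

sumBelow-+ : ∀ N (f g : ℕ → ℕ) → ∑[ i < N ] (f i + g i) ≡ sumBelow N f + sumBelow N g
sumBelow-+ zero    f g = refl
sumBelow-+ (suc N) f g = trans (cong (f 0 + g 0 +_) (sumBelow-+ N (f ∘ suc) (g ∘ suc)))
  (+-Comm.interchange (f 0) (g 0) (sumBelow N (f ∘ suc)) (sumBelow N (g ∘ suc)))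

*-distribˡ-sumBelow : ∀ N c (f : ℕ → ℕ) → c * sumBelow N f ≡ ∑[ i < N ] (c * f i)
*-distribˡ-sumBelow zero    c f = *-zeroʳ c
*-distribˡ-sumBelow (suc N) c f =
  trans (*-distribˡ-+ c (f 0) _) (cong (c * f 0 +_) (*-distribˡ-sumBelow N c (f ∘ suc)))

*-distribʳ-sumBelow : ∀ N c (f : ℕ → ℕ) → sumBelow N f * c ≡ ∑[ i < N ] (f i * c)
*-distribʳ-sumBelow N c f = begin
  sumBelow N f * c         ≡⟨ *-comm (sumBelow N f) c ⟩
  c * sumBelow N f         ≡⟨ *-distribˡ-sumBelow N c f ⟩
  ∑[ i < N ] (c * f i)     ≡⟨ sumBelow-cong N (λ i → *-comm c (f i)) ⟩
  ∑[ i < N ] (f i * c)     ∎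
  where open ≡-Reasoning

sumBelow-mono-≤ : ∀ N {f g : ℕ → ℕ} → (∀ i → i < N → f i ≤ g i) → sumBelow N f ≤ sumBelow N g
sumBelow-mono-≤ zero    f≤g = z≤n
sumBelow-mono-≤ (suc N) f≤g = +-mono-≤ (f≤g 0 z<s) (sumBelow-mono-≤ N (λ i i<N → f≤g (suc i) (s<s i<N)))

sumBelow-zero : ∀ N → ∑[ i < N ] 0 ≡ 0
sumBelow-zero zero    = refl
sumBelow-zero (suc N) = sumBelow-zero N

choose : ℕ → ℕ → ℕ
choose k       zero    = 1
choose zero    (suc i) = 0
choose (suc k) (suc i) = choose k i + choose k (suc i)

falling : ℕ → ℕ → ℕ
falling k       zero    = 1
falling zero    (suc i) = 0
falling (suc k) (suc i) = suc k * falling k i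

binomial-step : ∀ m k N →
  ∑[ i < suc N ] (choose (suc k) i * m ^ i) ≡
  m * (∑[ i < N ] (choose k i * m ^ i)) + ∑[ i < suc N ] (choose k i * m ^ i)
binomial-step m k N = begin
  1 + ∑[ i < N ] ((choose k i + choose k (suc i)) * (m * m ^ i))
    ≡⟨ cong (1 +_) (sumBelow-cong N (λ i → distrib (choose k i) (choose k (suc i)) m (m ^ i))) ⟩
  1 + ∑[ i < N ] (m * (choose k i * m ^ i) + choose k (suc i) * (m * m ^ i))
    ≡⟨ cong (1 +_) (sumBelow-+ N _ _) ⟩
  1 + (∑[ i < N ] (m * (choose k i * m ^ i)) + ∑[ i < N ] (choose k (suc i) * m ^ suc i))
    ≡⟨ cong (λ s → 1 + (s + ∑[ i < N ] (choose k (suc i) * m ^ suc i))) (*-distribˡ-sumBelow N m _) ⟨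
  1 + (m * ∑[ i < N ] (choose k i * m ^ i) + ∑[ i < N ] (choose k (suc i) * m ^ suc i))
    ≡⟨ +-Comm.x∙yz≈y∙xz 1 (m * ∑[ i < N ] (choose k i * m ^ i)) _ ⟩
  m * ∑[ i < N ] (choose k i * m ^ i) + (1 + ∑[ i < N ] (choose k (suc i) * m ^ suc i))
    ∎
  where
  open ≡-Reasoning
  distrib : ∀ a b m p → (a + b) * (m * p) ≡ m * (a * p) + b * (m * p)
  distrib = solve-∀

binomial-theorem : ∀ m k N → k < N → ∑[ i < N ] (choose k i * m ^ i) ≡ suc m ^ k
binomial-theorem m zero    (suc N) _ = cong (1 +_) (sumBelow-zero N)
binomial-theorem m (suc k) (suc N) (s≤s k<N) = begin
  ∑[ i < suc N ] (choose (suc k) i * m ^ i)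
    ≡⟨ binomial-step m k N ⟩
  m * ∑[ i < N ] (choose k i * m ^ i) + ∑[ i < suc N ] (choose k i * m ^ i)
    ≡⟨ cong₂ (λ a b → m * a + b) (binomial-theorem m k N k<N) (binomial-theorem m k (suc N) (m≤n⇒m≤1+n k<N)) ⟩
  m * suc m ^ k + suc m ^ k
    ≡⟨ +-comm (m * suc m ^ k) (suc m ^ k) ⟩
  suc m ^ suc k
    ∎
  where open ≡-Reasoning

falling-suc : ∀ k i → falling k (suc i) ≡ falling k i * (k ∸ i)
falling-suc zero    zero    = refl
falling-suc zero    (suc i) = refl
falling-suc (suc k) zero    = trans (*-identityʳ (suc k)) (sym (*-identityˡ (suc k)))
falling-suc (suc k) (suc i) = trans (cong (suc k *_) (falling-suc k i)) (sym (*-assoc (suc k) (falling k i) (k ∸ i)))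

falling-> : ∀ k i → k < i → falling k i ≡ 0
falling-> zero    (suc i) _         = refl
falling-> (suc k) (suc i) (s≤s k<i) = trans (cong (suc k *_) (falling-> k i k<i)) (*-zeroʳ (suc k))

choose*!≡falling : ∀ k i → choose k i * i ! ≡ falling k i
choose*!≡falling k       zero    = refl
choose*!≡falling zero    (suc i) = refl
choose*!≡falling (suc k) (suc i) = begin
  (choose k i + choose k (suc i)) * (suc i * i !)
    ≡⟨ distrib (choose k i) (choose k (suc i)) i (i !) ⟩
  suc i * (choose k i * i !) + choose k (suc i) * (suc i * i !)
    ≡⟨ cong₂ (λ a b → suc i * a + b) (choose*!≡falling k i) (choose*!≡falling k (suc i)) ⟩
  suc i * falling k i + falling k (suc i)
    ≡⟨ cong (suc i * falling k i +_) (falling-suc k i) ⟩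
  suc i * falling k i + falling k i * (k ∸ i)
    ≡⟨ pascal-falling ⟩
  suc k * falling k i
    ∎
  where
  open ≡-Reasoning
  distrib : ∀ a b i f → (a + b) * (suc i * f) ≡ suc i * (a * f) + b * (suc i * f)
  distrib = solve-∀
  pascal-falling : suc i * falling k i + falling k i * (k ∸ i) ≡ suc k * falling k i
  pascal-falling with i ≤? k
  ... | yes i≤k = begin
    suc i * falling k i + falling k i * (k ∸ i)   ≡⟨ cong (suc i * falling k i +_) (*-comm (falling k i) (k ∸ i)) ⟩
    suc i * falling k i + (k ∸ i) * falling k i   ≡⟨ *-distribʳ-+ (falling k i) (suc i) (k ∸ i) ⟨
    (suc i + (k ∸ i)) * falling k i               ≡⟨ cong (λ j → suc j * falling k i) (m+[n∸m]≡n i≤k) ⟩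
    suc k * falling k i                           ∎
  ... | no i≰k rewrite falling-> k i (≰⇒> i≰k) = trans (cong (_+ 0) (*-zeroʳ i)) (sym (*-zeroʳ k))

eSum≡sum-falling : ∀ k → eSum k ≡ ∑[ i < suc k ] falling k i
eSum≡sum-falling zero    = refl
eSum≡sum-falling (suc k) = begin
  suc k * eSum k + 1                          ≡⟨ +-comm (suc k * eSum k) 1 ⟩
  1 + suc k * eSum k                          ≡⟨ cong (λ s → 1 + suc k * s) (eSum≡sum-falling k) ⟩
  1 + suc k * ∑[ i < suc k ] falling k i      ≡⟨ cong (1 +_) (*-distribˡ-sumBelow (suc k) (suc k) (falling k)) ⟩
  1 + ∑[ i < suc k ] (suc k * falling k i)    ∎
  where open ≡-Reasoning

[i+j]!≤i!*[i+j]^j : ∀ i j → (i + j) ! ≤ i ! * (i + j) ^ j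
[i+j]!≤i!*[i+j]^j i zero rewrite +-identityʳ i | *-identityʳ (i !) = ≤-refl
[i+j]!≤i!*[i+j]^j i (suc j) rewrite +-suc i j = begin
  suc (i + j) * (i + j) !                ≤⟨ *-monoʳ-≤ (suc (i + j)) ([i+j]!≤i!*[i+j]^j i j) ⟩
  suc (i + j) * (i ! * (i + j) ^ j)      ≤⟨ *-monoʳ-≤ (suc (i + j)) (*-monoʳ-≤ (i !) (^-monoˡ-≤ j (n≤1+n (i + j)))) ⟩
  suc (i + j) * (i ! * suc (i + j) ^ j)  ≡⟨ *-Comm.x∙yz≈y∙xz (suc (i + j)) (i !) _ ⟩
  i ! * (suc (i + j) * suc (i + j) ^ j)  ∎
  where open ≤-Reasoning

!≤!*^∸ : ∀ i m → i ≤ m → m ! ≤ i ! * m ^ (m ∸ i)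
!≤!*^∸ i m i≤m =
  subst (λ k → k ! ≤ i ! * k ^ (m ∸ i)) (m+[n∸m]≡n i≤m) ([i+j]!≤i!*[i+j]^j i (m ∸ i))

choose*^*!≤falling*^ : ∀ m i → i ≤ m → choose m i * m ^ i * m ! ≤ falling m i * m ^ m
choose*^*!≤falling*^ m i i≤m = begin
  choose m i * m ^ i * m !                   ≤⟨ *-monoʳ-≤ (choose m i * m ^ i) (!≤!*^∸ i m i≤m) ⟩
  choose m i * m ^ i * (i ! * m ^ (m ∸ i))   ≡⟨ *-Comm.interchange (choose m i) (m ^ i) (i !) (m ^ (m ∸ i)) ⟩
  choose m i * i ! * (m ^ i * m ^ (m ∸ i))   ≡⟨ cong₂ _*_ (choose*!≡falling m i) (sym (^-distribˡ-+-* m i (m ∸ i))) ⟩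
  falling m i * m ^ (i + (m ∸ i))            ≡⟨ cong (λ k → falling m i * m ^ k) (m+[n∸m]≡n i≤m) ⟩
  falling m i * m ^ m                        ∎
  where open ≤-Reasoning

[1+m]^m*m!≤m^m*eSum : ∀ m → suc m ^ m * m ! ≤ m ^ m * eSum m
[1+m]^m*m!≤m^m*eSum m = begin
  suc m ^ m * m !                             ≡⟨ cong (_* m !) (binomial-theorem m m (suc m) ≤-refl) ⟨
  ∑[ i < suc m ] (choose m i * m ^ i) * m !   ≡⟨ *-distribʳ-sumBelow (suc m) (m !) (λ i → choose m i * m ^ i) ⟩
  ∑[ i < suc m ] (choose m i * m ^ i * m !)   ≤⟨ sumBelow-mono-≤ (suc m) (λ i i<1+m → choose*^*!≤falling*^ m i (≤-pred i<1+m)) ⟩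
  ∑[ i < suc m ] (falling m i * m ^ m)        ≡⟨ *-distribʳ-sumBelow (suc m) (m ^ m) (falling m) ⟨
  ∑[ i < suc m ] falling m i * m ^ m          ≡⟨ cong (_* m ^ m) (eSum≡sum-falling m) ⟨
  eSum m * m ^ m                              ≡⟨ *-comm (eSum m) (m ^ m) ⟩
  m ^ m * eSum m                              ∎
  where open ≤-Reasoning

-- 1/P ≤ D^D / (D + 1)^(D + 1) is the hypothesis of the symmetric local lemma
e*≤⇒[1+D]^[1+D]≤*^ : ∀ D P → e* (suc D) ≤ P → suc D ^ suc D ≤ P * D ^ D
e*≤⇒[1+D]^[1+D]≤*^ D P e[1+D]≤P = *-cancelˡ-≤ (D !) {{D !≢0}} (begin
  D ! * (suc D * suc D ^ D)     ≡⟨ *-Comm.x∙yz≈y∙zx (D !) (suc D) (suc D ^ D) ⟩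
  suc D * (suc D ^ D * D !)     ≤⟨ *-monoʳ-≤ (suc D) ([1+m]^m*m!≤m^m*eSum D) ⟩
  suc D * (D ^ D * eSum D)      ≡⟨ *-Comm.x∙yz≈y∙xz (suc D) (D ^ D) (eSum D) ⟩
  D ^ D * (suc D * eSum D)      ≤⟨ *-monoʳ-≤ (D ^ D) (e[1+D]≤P D) ⟩
  D ^ D * (P * D !)             ≡⟨ *-Comm.x∙yz≈z∙yx (D ^ D) P (D !) ⟩
  D ! * (P * D ^ D)             ∎)
  where open ≤-Reasoning

-- Counting colourings

𝟙 : Bool → ℕ
𝟙 true  = 1
𝟙 false = 0

count : ∀ {n} → (Vec Bool n → Bool) → ℕ
count {zero}  P = 𝟙 (P [])
count {suc n} P = count (P ∘ (false ∷_)) + count (P ∘ (true ∷_))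

count-cong : ∀ {n} {P Q : Vec Bool n → Bool} → (∀ x → P x ≡ Q x) → count P ≡ count Q
count-cong {zero}  P≗Q = cong 𝟙 (P≗Q [])
count-cong {suc n} P≗Q = cong₂ _+_ (count-cong (P≗Q ∘ (false ∷_))) (count-cong (P≗Q ∘ (true ∷_)))

𝟙-mono : ∀ {a b} → (a ≡ true → b ≡ true) → 𝟙 a ≤ 𝟙 b
𝟙-mono {true}  a⇒b rewrite a⇒b refl = ≤-refl
𝟙-mono {false} a⇒b = z≤n

count-mono : ∀ {n} {P Q : Vec Bool n → Bool} → (∀ x → P x ≡ true → Q x ≡ true) → count P ≤ count Q
count-mono {zero}  P⇒Q = 𝟙-mono (P⇒Q [])
count-mono {suc n} P⇒Q = +-mono-≤ (count-mono (P⇒Q ∘ (false ∷_))) (count-mono (P⇒Q ∘ (true ∷_)))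

𝟙-split : ∀ a b → 𝟙 a ≡ 𝟙 (a ∧ b) + 𝟙 (a ∧ not b)
𝟙-split true  true  = refl
𝟙-split true  false = refl
𝟙-split false b     = refl

count-split : ∀ {n} (P Q : Vec Bool n → Bool) →
  count P ≡ count (λ x → P x ∧ Q x) + count (λ x → P x ∧ not (Q x))
count-split {zero}  P Q = 𝟙-split (P []) (Q [])
count-split {suc n} P Q = trans
  (cong₂ _+_ (count-split (P ∘ (false ∷_)) (Q ∘ (false ∷_))) (count-split (P ∘ (true ∷_)) (Q ∘ (true ∷_))))
  (+-Comm.interchange (count (λ x → P (false ∷ x) ∧ Q (false ∷ x))) _ _ _)

count-false : ∀ {n} → count {n} (λ _ → false) ≡ 0
count-false {zero}  = refl
count-false {suc n} = cong₂ _+_ (count-false {n}) (count-false {n})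

count-never : ∀ {n} (P : Vec Bool n → Bool) → (∀ x → P x ≢ true) → count P ≡ 0
count-never {n} P never = n≤0⇒n≡0 (≤-trans (count-mono (λ x Px → ⊥-elim (never x Px))) (≤-reflexive (count-false {n})))

witness⇒0<count : ∀ {n} (P : Vec Bool n → Bool) x → P x ≡ true → 0 < count P
witness⇒0<count P []            Px rewrite Px = ≤-refl
witness⇒0<count P (false ∷ x) Px = ≤-trans (witness⇒0<count (P ∘ (false ∷_)) x Px) (m≤m+n _ _)
witness⇒0<count P (true ∷ x)  Px = ≤-trans (witness⇒0<count (P ∘ (true ∷_)) x Px) (m≤n+m _ _)

0<count⇒witness : ∀ {n} (P : Vec Bool n → Bool) → 0 < count P → Σ (Vec Bool n) (λ x → P x ≡ true)
0<count⇒witness {zero} P 0<c with P [] in Px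
... | true = [] , Px
0<count⇒witness {suc n} P 0<c with count (P ∘ (false ∷_)) in c₀
... | suc _ with 0<count⇒witness (P ∘ (false ∷_)) (subst (0 <_) (sym c₀) z<s)
...   | x , Px = false ∷ x , Px
0<count⇒witness {suc n} P 0<c | zero with 0<count⇒witness (P ∘ (true ∷_)) 0<c
...   | x , Px = true ∷ x , Px

toggle : ∀ {n} → Fin n → Vec Bool n → Vec Bool n
toggle i x = updateAt x i not

count-toggle : ∀ {n} (i : Fin n) (P : Vec Bool n → Bool) → count (P ∘ toggle i) ≡ count P
count-toggle {suc n} zero    P = +-comm (count (P ∘ (true ∷_))) _
count-toggle {suc n} (suc i) P =
  cong₂ _+_ (count-toggle i (P ∘ (false ∷_))) (count-toggle i (P ∘ (true ∷_)))

-- Toggling coordinate i is a bijection that preserves F and c and swaps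
-- the two halves of F according to whether x i agrees with c.
count-halves : ∀ {n} (i : Fin n) (F c : Vec Bool n → Bool) →
  (∀ x → F (toggle i x) ≡ F x) → (∀ x → c (toggle i x) ≡ c x) →
  2 * count (λ x → F x ∧ (lookup x i xor c x)) ≡ count F
count-halves i F c F-inv c-inv = begin
  2 * count E                                          ≡⟨ cong (count E +_) (+-identityʳ (count E)) ⟩
  count E + count E                                    ≡⟨ cong (count E +_) (count-toggle i E) ⟨
  count E + count (E ∘ toggle i)                       ≡⟨ cong (count E +_) (count-cong E∘toggle) ⟩
  count E + count (λ x → F x ∧ not (lookup x i xor c x)) ≡⟨ count-split F (λ x → lookup x i xor c x) ⟨
  count F                                              ∎
  where
  open ≡-Reasoning
  E : Vec Bool _ → Bool
  E x = F x ∧ (lookup x i xor c x)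
  E∘toggle : ∀ x → E (toggle i x) ≡ (F x ∧ not (lookup x i xor c x))
  E∘toggle x rewrite F-inv x | c-inv x | lookup∘updateAt i {not} x =
    cong (F x ∧_) (sym (not-distribˡ-xor (lookup x i) (c x)))

_==_ : ∀ {n} → Fin n → Fin n → Bool
a == b = does (a ≟ b)

==-refl : ∀ {n} (a : Fin n) → (a == a) ≡ true
==-refl a = dec-true (a ≟ a) refl

allᶠ : ∀ {k} → (Fin k → Bool) → Bool
allᶠ {zero}  p = true
allᶠ {suc k} p = p zero ∧ allᶠ (p ∘ suc)

allᶠ-elim : ∀ {k} {p : Fin k → Bool} → allᶠ p ≡ true → ∀ w → p w ≡ true
allᶠ-elim {p = p} all-p zero    = ∧-conicalˡ (p zero) _ all-p
allᶠ-elim {p = p} all-p (suc w) = allᶠ-elim (∧-conicalʳ (p zero) _ all-p) w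

allᶠ-intro : ∀ {k} {p : Fin k → Bool} → (∀ w → p w ≡ true) → allᶠ p ≡ true
allᶠ-intro {zero}  p-true = refl
allᶠ-intro {suc k} p-true rewrite p-true zero = allᶠ-intro (p-true ∘ suc)

allᶠ-cong : ∀ {k} {p q : Fin k → Bool} → (∀ w → p w ≡ q w) → allᶠ p ≡ allᶠ q
allᶠ-cong {zero}  p≗q = refl
allᶠ-cong {suc k} p≗q = cong₂ _∧_ (p≗q zero) (allᶠ-cong (p≗q ∘ suc))

allᶠ-∧ : ∀ {k} (p q : Fin k → Bool) → allᶠ (λ w → p w ∧ q w) ≡ allᶠ p ∧ allᶠ q
allᶠ-∧ {zero}  p q = refl
allᶠ-∧ {suc k} p q = trans (cong ((p zero ∧ q zero) ∧_) (allᶠ-∧ (p ∘ suc) (q ∘ suc))) (∧-Comm.interchange (p zero) (q zero) _ _)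

allᶠ-true : ∀ {k} → allᶠ {k} (λ _ → true) ≡ true
allᶠ-true {k} = allᶠ-intro {k} (λ _ → refl)

allᶠ-except : ∀ {k} (u : Fin k) (b : Fin k → Bool) → allᶠ (λ w → not ((w == u) ∧ b w)) ≡ not (b u)
allᶠ-except {suc k} zero b = trans (cong (not (b zero) ∧_) (allᶠ-true {k})) (∧-identityʳ (not (b zero)))
allᶠ-except {suc k} (suc u) b = allᶠ-except u (b ∘ suc)

size : ∀ {k} → (Fin k → Bool) → ℕ
size {zero}  p = 0
size {suc k} p = 𝟙 (p zero) + size (p ∘ suc)

size-mono : ∀ {k} {p q : Fin k → Bool} → (∀ w → p w ≡ true → q w ≡ true) → size p ≤ size q
size-mono {zero}  p⊆q = z≤n
size-mono {suc k} p⊆q = +-mono-≤ (𝟙-mono (p⊆q zero)) (size-mono (p⊆q ∘ suc))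

size-∨ : ∀ {k} (p q : Fin k → Bool) → size (λ w → p w ∨ q w) ≤ size p + size q
size-∨ {zero}  p q = z≤n
size-∨ {suc k} p q = begin
  𝟙 (p zero ∨ q zero) + size (λ w → p (suc w) ∨ q (suc w))
    ≤⟨ +-mono-≤ (𝟙-∨ (p zero) (q zero)) (size-∨ (p ∘ suc) (q ∘ suc)) ⟩
  (𝟙 (p zero) + 𝟙 (q zero)) + (size (p ∘ suc) + size (q ∘ suc))
    ≡⟨ +-Comm.interchange (𝟙 (p zero)) (𝟙 (q zero)) _ _ ⟩
  (𝟙 (p zero) + size (p ∘ suc)) + (𝟙 (q zero) + size (q ∘ suc))
    ∎
  where
  open ≤-Reasoning
  𝟙-∨ : ∀ a b → 𝟙 (a ∨ b) ≤ 𝟙 a + 𝟙 b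
  𝟙-∨ true  b = s≤s z≤n
  𝟙-∨ false b = ≤-refl

size-split : ∀ {k} (p q : Fin k → Bool) → size p ≡ size (λ w → p w ∧ q w) + size (λ w → p w ∧ not (q w))
size-split {zero}  p q = refl
size-split {suc k} p q = trans (cong₂ _+_ (𝟙-split (p zero) (q zero)) (size-split (p ∘ suc) (q ∘ suc)))
  (+-Comm.interchange (𝟙 (p zero ∧ q zero)) (𝟙 (p zero ∧ not (q zero))) _ _)

member⇒0<size : ∀ {k} (p : Fin k → Bool) w → p w ≡ true → 0 < size p
member⇒0<size p zero    pw rewrite pw = s≤s z≤n
member⇒0<size p (suc w) pw = ≤-trans (member⇒0<size (p ∘ suc) w pw) (m≤n+m _ _)

0<size⇒member : ∀ {k} (p : Fin k → Bool) → 0 < size p → Σ (Fin k) (λ w → p w ≡ true)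
0<size⇒member {suc k} p 0<size with p zero in p₀
... | true  = zero , p₀
... | false with 0<size⇒member (p ∘ suc) 0<size
...   | w , pw = suc w , pw

size-⊂ : ∀ {k} {p q : Fin k → Bool} u → (∀ w → p w ≡ true → q w ≡ true) →
  p u ≡ false → q u ≡ true → size p < size q
size-⊂ {suc k} {p} {q} zero    p⊆q pu qu rewrite pu | qu = s≤s (size-mono (p⊆q ∘ suc))
size-⊂ {suc k} {p} {q} (suc u) p⊆q pu qu = begin-strict
  𝟙 (p zero) + size (p ∘ suc)   <⟨ +-mono-≤-< (𝟙-mono (p⊆q zero)) (size-⊂ u (p⊆q ∘ suc) pu qu) ⟩
  𝟙 (q zero) + size (q ∘ suc)   ∎
  where open ≤-Reasoning

size-∅ : ∀ {k} → size {k} (λ _ → false) ≡ 0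
size-∅ {zero}  = refl
size-∅ {suc k} = size-∅ {k}

size-singleton : ∀ {k} (u : Fin k) → size (_== u) ≡ 1
size-singleton {suc k} zero    = cong suc (size-∅ {k})
size-singleton (suc u) = size-singleton u

length-filterᵇ-tabulate : ∀ {k m} (p : Fin k → Bool) (f : Fin m → Fin k) →
  length (filterᵇ p (tabulate f)) ≡ size (p ∘ f)
length-filterᵇ-tabulate {m = zero}  p f = refl
length-filterᵇ-tabulate {m = suc m} p f with p (f zero)
... | true  = cong suc (length-filterᵇ-tabulate p (f ∘ suc))
... | false = length-filterᵇ-tabulate p (f ∘ suc)

length-filterᵇ-allFin : ∀ {k} (p : Fin k → Bool) → length (filterᵇ p (allFin k)) ≡ size p
length-filterᵇ-allFin p = length-filterᵇ-tabulate p id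

_∈ᵇ_ : ∀ {n} → Fin n → List (Fin n) → Bool
u ∈ᵇ ys = any (u ==_) ys

Nodup : ∀ {n} → List (Fin n) → Set
Nodup []       = ⊤
Nodup (y ∷ ys) = (y ∈ᵇ ys ≡ false) × Nodup ys

∈ᵇ-here : ∀ {n} (y : Fin n) ys → y ∈ᵇ (y ∷ ys) ≡ true
∈ᵇ-here y ys = cong (_∨ y ∈ᵇ ys) (==-refl y)

∈ᵇ-there : ∀ {n} (u y : Fin n) ys → u ∈ᵇ ys ≡ true → u ∈ᵇ (y ∷ ys) ≡ true
∈ᵇ-there u y ys u∈ = trans (cong ((u == y) ∨_) u∈) (∨-zeroʳ (u == y))

∉ᵇ-∷⁻ : ∀ {n} (u y : Fin n) ys → u ∈ᵇ (y ∷ ys) ≡ false → u ≢ y × u ∈ᵇ ys ≡ false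
∉ᵇ-∷⁻ u y ys u∉ = (λ { refl → case trans (sym (∈ᵇ-here u ys)) u∉ of λ () }) , ∨-conicalʳ (u == y) _ u∉

∈ᵇ-∉ᵇ⇒≢ : ∀ {n} {y u : Fin n} ys → y ∈ᵇ ys ≡ true → u ∈ᵇ ys ≡ false → y ≢ u
∈ᵇ-∉ᵇ⇒≢ ys y∈ u∉ refl with () ← trans (sym y∈) u∉

∈ᵇ-filterᵇ : ∀ {n} (p : Fin n → Bool) u ys → u ∈ᵇ filterᵇ p ys ≡ p u ∧ u ∈ᵇ ys
∈ᵇ-filterᵇ p u []       = sym (∧-zeroʳ (p u))
∈ᵇ-filterᵇ p u (y ∷ ys) with p y in py
... | true with u ≟ y
...   | yes refl = sym (trans (∧-identityʳ (p u)) py)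
...   | no _     = ∈ᵇ-filterᵇ p u ys
∈ᵇ-filterᵇ p u (y ∷ ys) | false with u ≟ y
...   | yes refl = trans (∈ᵇ-filterᵇ p u ys) (trans (cong (_∧ u ∈ᵇ ys) py) (sym (cong (_∧ true) py)))
...   | no _     = ∈ᵇ-filterᵇ p u ys

∈ᵇ-filterᵇ-≢⁻ : ∀ {n} (a u : Fin n) ys → u ∈ᵇ filterᵇ (λ w → not (w == a)) ys ≡ true → u ∈ᵇ ys ≡ true × u ≢ a
∈ᵇ-filterᵇ-≢⁻ a u ys u∈ with u ≟ a | ∈ᵇ-filterᵇ (λ w → not (w == a)) u ys
... | yes refl | u∈≡ with () ← trans (sym u∈) u∈≡
... | no u≢a   | u∈≡ = trans (sym u∈≡) u∈ , u≢a

∈ᵇ-tabulate : ∀ {n m} (f : Fin m → Fin n) i → f i ∈ᵇ tabulate f ≡ true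
∈ᵇ-tabulate f zero    = ∈ᵇ-here (f zero) (tabulate (f ∘ suc))
∈ᵇ-tabulate f (suc i) = ∈ᵇ-there (f (suc i)) (f zero) (tabulate (f ∘ suc)) (∈ᵇ-tabulate (f ∘ suc) i)

∈ᵇ-tabulate⁻ : ∀ {n m} (f : Fin m → Fin n) u → u ∈ᵇ tabulate f ≡ true → Σ (Fin m) (λ i → f i ≡ u)
∈ᵇ-tabulate⁻ {m = suc m} f u u∈ with u ≟ f zero
... | yes u≡f₀ = zero , sym u≡f₀
... | no _ with ∈ᵇ-tabulate⁻ (f ∘ suc) u u∈
...   | i , fi≡u = suc i , fi≡u

∈ᵇ-allFin : ∀ {n} (u : Fin n) → u ∈ᵇ allFin n ≡ true
∈ᵇ-allFin = ∈ᵇ-tabulate id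

∈ᵇ-filterᵇ-allFin : ∀ {n} (p : Fin n → Bool) u → u ∈ᵇ filterᵇ p (allFin n) ≡ p u
∈ᵇ-filterᵇ-allFin p u = trans (∈ᵇ-filterᵇ p u (allFin _)) (trans (cong (p u ∧_) (∈ᵇ-allFin u)) (∧-identityʳ (p u)))

∈ᵇ-take : ∀ {n} m (ys : List (Fin n)) u → u ∈ᵇ take m ys ≡ true → u ∈ᵇ ys ≡ true
∈ᵇ-take (suc m) (y ∷ ys) u u∈ with u == y
... | true  = refl
... | false = ∈ᵇ-take m ys u u∈

∉ᵇ-take : ∀ {n} m (ys : List (Fin n)) u → u ∈ᵇ ys ≡ false → u ∈ᵇ take m ys ≡ false
∉ᵇ-take m ys u u∉ with u ∈ᵇ take m ys in u∈
... | false = refl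
... | true  = trans (sym (∈ᵇ-take m ys u u∈)) u∉

Nodup-filterᵇ : ∀ {n} (p : Fin n → Bool) ys → Nodup ys → Nodup (filterᵇ p ys)
Nodup-filterᵇ p []       _             = tt
Nodup-filterᵇ p (y ∷ ys) (y∉ys , nodup) with p y
... | true  = trans (∈ᵇ-filterᵇ p y ys) (trans (cong (_ ∧_) y∉ys) (∧-zeroʳ _)) , Nodup-filterᵇ p ys nodup
... | false = Nodup-filterᵇ p ys nodup

Nodup-take : ∀ {n} m (ys : List (Fin n)) → Nodup ys → Nodup (take m ys)
Nodup-take zero    ys       _             = tt
Nodup-take (suc m) []       _             = tt
Nodup-take (suc m) (y ∷ ys) (y∉ys , nodup) = ∉ᵇ-take m ys y y∉ys , Nodup-take m ys nodup

Nodup-tabulate : ∀ {n m} (f : Fin m → Fin n) → (∀ i j → f i ≡ f j → i ≡ j) → Nodup (tabulate f)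
Nodup-tabulate {m = zero}  f f-inj = tt
Nodup-tabulate {m = suc m} f f-inj = f₀∉ , Nodup-tabulate (f ∘ suc) (λ i j fi≡fj → Finₚ.suc-injective (f-inj _ _ fi≡fj))
  where
  f₀∉ : f zero ∈ᵇ tabulate (f ∘ suc) ≡ false
  f₀∉ with f zero ∈ᵇ tabulate (f ∘ suc) in f₀∈
  ... | false = refl
  ... | true with ∈ᵇ-tabulate⁻ (f ∘ suc) (f zero) f₀∈
  ...   | i , fi≡f₀ with () ← f-inj (suc i) zero fi≡f₀

Nodup-allFin : ∀ n → Nodup (allFin n)
Nodup-allFin n = Nodup-tabulate id (λ _ _ i≡j → i≡j)

filterᵇ-≢-∉ : ∀ {n} (a : Fin n) ys → a ∈ᵇ ys ≡ false → filterᵇ (λ u → not (u == a)) ys ≡ ys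
filterᵇ-≢-∉ a []       _   = refl
filterᵇ-≢-∉ a (y ∷ ys) a∉ with y ≟ a
... | yes refl with () ← trans (sym (∈ᵇ-here a ys)) a∉
... | no _     = cong (y ∷_) (filterᵇ-≢-∉ a ys (∨-conicalʳ (a == y) _ a∉))

length≤1+length-filterᵇ-≢ : ∀ {n} (a : Fin n) ys → Nodup ys →
  length ys ≤ suc (length (filterᵇ (λ u → not (u == a)) ys))
length≤1+length-filterᵇ-≢ a []       _              = z≤n
length≤1+length-filterᵇ-≢ a (y ∷ ys) (y∉ys , nodup) with y ≟ a
... | yes refl = ≤-reflexive (cong (suc ∘ length) (sym (filterᵇ-≢-∉ y ys y∉ys)))
... | no _     = s≤s (length≤1+length-filterᵇ-≢ a ys nodup)

all-elim : ∀ {n} (p : Fin n → Bool) ys → all p ys ≡ true → ∀ u → u ∈ᵇ ys ≡ true → p u ≡ true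
all-elim p (y ∷ ys) all-p u u∈ with u ≟ y
... | yes refl = ∧-conicalˡ (p y) _ all-p
... | no _     = all-elim p ys (∧-conicalʳ (p y) _ all-p) u u∈

all-intro : ∀ {n} (p : Fin n → Bool) ys → (∀ u → u ∈ᵇ ys ≡ true → p u ≡ true) → all p ys ≡ true
all-intro p []       p-true = refl
all-intro p (y ∷ ys) p-true rewrite p-true y (∈ᵇ-here y ys) =
  all-intro p ys (λ u u∈ → p-true u (∈ᵇ-there u y ys u∈))

all-cong-∈ : ∀ {n} {p q : Fin n → Bool} ys → (∀ u → u ∈ᵇ ys ≡ true → p u ≡ q u) → all p ys ≡ all q ys
all-cong-∈ []       p≗q = refl
all-cong-∈ (y ∷ ys) p≗q = cong₂ _∧_ (p≗q y (∈ᵇ-here y ys)) (all-cong-∈ ys (λ u u∈ → p≗q u (∈ᵇ-there u y ys u∈)))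

all-filterᵇ : ∀ {n} (p q : Fin n → Bool) ys → all p ys ≡ true → all p (filterᵇ q ys) ≡ true
all-filterᵇ p q ys all-p = all-intro p (filterᵇ q ys) (λ u u∈ →
  all-elim p ys all-p u (∧-conicalʳ (q u) _ (trans (sym (∈ᵇ-filterᵇ q u ys)) u∈)))

all-false⇒witness : ∀ {n} (p : Fin n → Bool) ys → all p ys ≡ false →
  Σ (Fin n) (λ u → u ∈ᵇ ys ≡ true × p u ≡ false)
all-false⇒witness p (y ∷ ys) ¬all-p with p y in py
... | false = y , ∈ᵇ-here y ys , py
... | true with all-false⇒witness p ys ¬all-p
...   | u , u∈ , pu = u , ∈ᵇ-there u y ys u∈ , pu

any-false-elim : ∀ {n} (p : Fin n → Bool) ys → any p ys ≡ false → ∀ u → u ∈ᵇ ys ≡ true → p u ≡ false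
any-false-elim p (y ∷ ys) ¬any-p u u∈ with u ≟ y
... | yes refl = ∨-conicalˡ (p y) _ ¬any-p
... | no _     = any-false-elim p ys (∨-conicalʳ (p y) _ ¬any-p) u u∈

any-mono-∈ : ∀ {n} {p q : Fin n → Bool} ys → (∀ u → u ∈ᵇ ys ≡ true → p u ≡ true → q u ≡ true) →
  any p ys ≡ true → any q ys ≡ true
any-mono-∈ {p = p} {q} (y ∷ ys) p⇒q any-p with p y in py
... | true rewrite p⇒q y (∈ᵇ-here y ys) py = refl
... | false with q y
...   | true  = refl
...   | false = any-mono-∈ ys (λ u u∈ → p⇒q u (∈ᵇ-there u y ys u∈)) any-p

size-any≤length* : ∀ {n k} (Q : Fin n → Fin k → Bool) ys δ → (∀ u → u ∈ᵇ ys ≡ true → size (Q u) ≤ δ) →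
  size (λ w → any (λ u → Q u w) ys) ≤ length ys * δ
size-any≤length* {k = k} Q [] δ _ = ≤-reflexive (size-∅ {k})
size-any≤length* Q (y ∷ ys) δ Q≤δ = ≤-trans (size-∨ (Q y) _)
  (+-mono-≤ (Q≤δ y (∈ᵇ-here y ys)) (size-any≤length* Q ys δ (λ u u∈ → Q≤δ u (∈ᵇ-there u y ys u∈))))

-- The symmetric local lemma, counting version

pow-ratio-mono : ∀ {a b j D M₂ M} → a ≤ b → j ≤ D → a ^ j * M₂ ≤ b ^ j * M → a ^ D * M₂ ≤ b ^ D * M
pow-ratio-mono {a} {b} {j} {D} {M₂} {M} a≤b j≤D ratio = subst (λ i → a ^ i * M₂ ≤ b ^ i * M) (m+[n∸m]≡n j≤D) (begin
  a ^ (j + i) * M₂        ≡⟨ cong (_* M₂) (^-distribˡ-+-* a j i) ⟩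
  a ^ j * a ^ i * M₂      ≡⟨ *-Comm.xy∙z≈y∙xz (a ^ j) (a ^ i) M₂ ⟩
  a ^ i * (a ^ j * M₂)    ≤⟨ *-mono-≤ (^-monoˡ-≤ i a≤b) ratio ⟩
  b ^ i * (b ^ j * M)     ≡⟨ *-Comm.xy∙z≈y∙xz (b ^ j) (b ^ i) M ⟨
  b ^ j * b ^ i * M       ≡⟨ cong (_* M) (^-distribˡ-+-* b j i) ⟨
  b ^ (j + i) * M         ∎)
  where
  open ≤-Reasoning
  i = D ∸ j

local-lemma-arith : ∀ D P {B B₂ M₂ M} → B ≤ B₂ → P * B₂ ≤ M₂ → D ^ D * M₂ ≤ suc D ^ D * M →
  suc D ^ suc D ≤ P * D ^ D → suc D * B ≤ M
local-lemma-arith D P {B} {B₂} {M₂} {M} B≤B₂ PB₂≤M₂ ratio small =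
  *-cancelˡ-≤ (P * D ^ D) {{>-nonZero (≤-trans (m^n>0 (suc D) (suc D)) small)}} (begin
    P * D ^ D * (suc D * B)     ≡⟨ rearrange P (D ^ D) (suc D) B ⟩
    suc D * (D ^ D * (P * B))   ≤⟨ *-monoʳ-≤ (suc D) (*-monoʳ-≤ (D ^ D) (≤-trans (*-monoʳ-≤ P B≤B₂) PB₂≤M₂)) ⟩
    suc D * (D ^ D * M₂)        ≤⟨ *-monoʳ-≤ (suc D) ratio ⟩
    suc D * (suc D ^ D * M)     ≡⟨ *-assoc (suc D) (suc D ^ D) M ⟨
    suc D ^ suc D * M           ≤⟨ *-monoˡ-≤ M small ⟩
    P * D ^ D * M               ∎)
  where
  open ≤-Reasoning
  rearrange : ∀ p x s b → p * x * (s * b) ≡ s * (x * (p * b))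
  rearrange = solve-∀

module LocalLemma {m k : ℕ} (Ω : Vec Bool m → Bool) (A : Fin k → Vec Bool m → Bool) where

  avoids : (Fin k → Bool) → Vec Bool m → Bool
  avoids S x = allᶠ (λ w → not (S w ∧ A w x))

  #avoid : (Fin k → Bool) → ℕ
  #avoid S = count (λ x → Ω x ∧ avoids S x)

  #avoid-hit : (Fin k → Bool) → Fin k → ℕ
  #avoid-hit S v = count (λ x → (Ω x ∧ avoids S x) ∧ A v x)

  avoids-elim : ∀ {S x} → avoids S x ≡ true → ∀ w → S w ≡ true → A w x ≡ false
  avoids-elim {S} {x} avoid w Sw with A w x | allᶠ-elim avoid w
  ... | false | _ = refl
  ... | true  | ¬Sw rewrite Sw with () ← ¬Sw

  avoids-cong : ∀ {S S′} → (∀ w → S w ≡ S′ w) → ∀ x → avoids S x ≡ avoids S′ x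
  avoids-cong S≗S′ x = allᶠ-cong (λ w → cong (λ b → not (b ∧ A w x)) (S≗S′ w))

  avoids-resp : ∀ {S} (f : Vec Bool m → Vec Bool m) x → (∀ w → S w ≡ true → A w (f x) ≡ A w x) →
    avoids S (f x) ≡ avoids S x
  avoids-resp {S} f x A-resp = allᶠ-cong avoid-w
    where
    avoid-w : ∀ w → not (S w ∧ A w (f x)) ≡ not (S w ∧ A w x)
    avoid-w w with S w in Sw
    ... | false = refl
    ... | true  = cong not (A-resp w Sw)

  avoids-mono : ∀ {S S′} → (∀ w → S′ w ≡ true → S w ≡ true) → ∀ x → avoids S x ≡ true → avoids S′ x ≡ true
  avoids-mono {S} {S′} S′⊆S x avoid = allᶠ-intro avoid-w
    where
    avoid-w : ∀ w → not (S′ w ∧ A w x) ≡ true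
    avoid-w w with S′ w in S′w
    ... | false = refl
    ... | true rewrite avoids-elim avoid w (S′⊆S w S′w) = refl

  avoids-insert : ∀ {S T} u → (∀ w → S w ≡ (T w ∨ (w == u))) → ∀ x → avoids S x ≡ (avoids T x ∧ not (A u x))
  avoids-insert {S} {T} u S≡T+u x = begin
    avoids S x
      ≡⟨ allᶠ-cong (λ w → trans (cong (λ b → not (b ∧ A w x)) (S≡T+u w)) (not-∨-∧ (T w) (w == u) (A w x))) ⟩
    allᶠ (λ w → not (T w ∧ A w x) ∧ not ((w == u) ∧ A w x))
      ≡⟨ allᶠ-∧ (λ w → not (T w ∧ A w x)) (λ w → not ((w == u) ∧ A w x)) ⟩
    avoids T x ∧ allᶠ (λ w → not ((w == u) ∧ A w x))
      ≡⟨ cong (avoids T x ∧_) (allᶠ-except u (λ w → A w x)) ⟩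
    avoids T x ∧ not (A u x)
      ∎
    where
    open ≡-Reasoning
    not-∨-∧ : ∀ a b c → not ((a ∨ b) ∧ c) ≡ (not (a ∧ c) ∧ not (b ∧ c))
    not-∨-∧ true  b     true  = refl
    not-∨-∧ true  true  false = refl
    not-∨-∧ true  false false = refl
    not-∨-∧ false b     c     = refl

  #avoid-cong : ∀ {S S′} → (∀ w → S w ≡ S′ w) → #avoid S ≡ #avoid S′
  #avoid-cong S≗S′ = count-cong (λ x → cong (Ω x ∧_) (avoids-cong S≗S′ x))

  #avoid-hit-anti : ∀ {S S′} v → (∀ w → S′ w ≡ true → S w ≡ true) → #avoid-hit S v ≤ #avoid-hit S′ v
  #avoid-hit-anti {S} {S′} v S′⊆S = count-mono hit⇒hit′
    where
    hit⇒hit′ : ∀ x → ((Ω x ∧ avoids S x) ∧ A v x) ≡ true → ((Ω x ∧ avoids S′ x) ∧ A v x) ≡ true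
    hit⇒hit′ x hit with Ω x | avoids S x in avoid | A v x
    ... | true | true | true rewrite avoids-mono S′⊆S x avoid = refl

  #avoid-insert : ∀ {S T} u → (∀ w → S w ≡ (T w ∨ (w == u))) → #avoid T ≡ #avoid-hit T u + #avoid S
  #avoid-insert {S} {T} u S≡T+u = trans (count-split (λ x → Ω x ∧ avoids T x) (A u))
    (cong (#avoid-hit T u +_) (count-cong (λ x →
      trans (∧-assoc (Ω x) (avoids T x) (not (A u x))) (cong (Ω x ∧_) (sym (avoids-insert u S≡T+u x))))))

  #avoid-hit-member : ∀ S v → S v ≡ true → #avoid-hit S v ≡ 0
  #avoid-hit-member S v Sv = count-never _ never
    where
    never : ∀ x → ((Ω x ∧ avoids S x) ∧ A v x) ≢ true
    never x hit with () ← trans (sym (∧-conicalʳ _ (A v x) hit))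
                                (avoids-elim (∧-conicalʳ (Ω x) _ (∧-conicalˡ _ (A v x) hit)) v Sv)

  #avoid-step : ∀ {D S T} u → (∀ w → S w ≡ (T w ∨ (w == u))) →
    (T u ≡ false → suc D * #avoid-hit T u ≤ #avoid T) → D * #avoid T ≤ suc D * #avoid S
  #avoid-step {D} {S} {T} u S≡T+u hit-bound with T u in Tu
  ... | true = begin
    D * #avoid T                      ≤⟨ *-monoˡ-≤ (#avoid T) (n≤1+n D) ⟩
    suc D * #avoid T                  ≡⟨ cong (suc D *_) (#avoid-insert u S≡T+u) ⟩
    suc D * (#avoid-hit T u + #avoid S) ≡⟨ cong (λ h → suc D * (h + #avoid S)) (#avoid-hit-member T u Tu) ⟩
    suc D * #avoid S                  ∎
    where open ≤-Reasoning
  ... | false = +-cancelˡ-≤ (#avoid T) _ _ (begin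
    suc D * #avoid T                                ≡⟨ cong (suc D *_) (#avoid-insert u S≡T+u) ⟩
    suc D * (#avoid-hit T u + #avoid S)             ≡⟨ *-distribˡ-+ (suc D) (#avoid-hit T u) (#avoid S) ⟩
    suc D * #avoid-hit T u + suc D * #avoid S       ≤⟨ +-monoˡ-≤ (suc D * #avoid S) (hit-bound refl) ⟩
    #avoid T + suc D * #avoid S                     ∎)
    where open ≤-Reasoning

  #avoid-chain : ∀ D T us →
    (∀ T′ u → u ∈ᵇ us ≡ true → (∀ w → T′ w ≡ true → (T w ∨ w ∈ᵇ us) ≡ true) → T′ u ≡ false →
      suc D * #avoid-hit T′ u ≤ #avoid T′) →
    D ^ length us * #avoid T ≤ suc D ^ length us * #avoid (λ w → T w ∨ w ∈ᵇ us)
  #avoid-chain D T [] _ = *-monoʳ-≤ 1 (≤-reflexive (#avoid-cong (λ w → sym (∨-identityʳ (T w)))))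
  #avoid-chain D T (u ∷ us) hit-bound = begin
    D * D ^ j * #avoid T                ≡⟨ *-assoc D (D ^ j) (#avoid T) ⟩
    D * (D ^ j * #avoid T)              ≤⟨ *-monoʳ-≤ D (#avoid-chain D T us (λ T′ u′ u′∈ ⊆T′ → hit-bound T′ u′ (∈ᵇ-there u′ u us u′∈) (λ w T′w → ⊆T+u w (⊆T′ w T′w)))) ⟩
    D * (suc D ^ j * #avoid T″)         ≡⟨ *-Comm.x∙yz≈y∙xz D (suc D ^ j) (#avoid T″) ⟩
    suc D ^ j * (D * #avoid T″)         ≤⟨ *-monoʳ-≤ (suc D ^ j) (#avoid-step {D} u T+u≡T″+u (hit-bound T″ u (∈ᵇ-here u us) ⊆T+u)) ⟩
    suc D ^ j * (suc D * #avoid T+u)    ≡⟨ *-Comm.x∙yz≈yx∙z (suc D ^ j) (suc D) (#avoid T+u) ⟩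
    suc D * suc D ^ j * #avoid T+u      ∎
    where
    open ≤-Reasoning
    j = length us
    T″ T+u : Fin k → Bool
    T″ w = T w ∨ w ∈ᵇ us
    T+u w = T w ∨ w ∈ᵇ (u ∷ us)
    T+u≡T″+u : ∀ w → T+u w ≡ (T″ w ∨ (w == u))
    T+u≡T″+u w = trans (cong (T w ∨_) (∨-comm (w == u) (w ∈ᵇ us))) (sym (∨-assoc (T w) (w ∈ᵇ us) (w == u)))
    ⊆T+u : ∀ w → T″ w ≡ true → T+u w ≡ true
    ⊆T+u w T″w = trans (T+u≡T″+u w) (cong (_∨ (w == u)) T″w)

  -- independent-bound: given Ω and the avoidance of events it does not depend
  -- on, A v has conditional probability at most 1/P. conditional-bound improves
  -- this to 1/(D + 1) for the avoidance of arbitrary sets of events.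
  module _ (dep : Fin k → Fin k → Bool) (D P : ℕ) (0<D : 0 < D)
           (dep-degree : ∀ v → size (λ w → dep v w ∧ not (w == v)) ≤ D)
           (independent-bound : ∀ S v → (∀ w → S w ≡ true → dep v w ≡ false) → P * #avoid-hit S v ≤ #avoid S)
           (P-large : suc D ^ suc D ≤ P * D ^ D) where

    dependent independent : (Fin k → Bool) → Fin k → Fin k → Bool
    dependent   S v w = S w ∧ dep v w
    independent S v w = S w ∧ not (dep v w)

    |dependent|≤D : ∀ S v → S v ≡ false → length (filterᵇ (dependent S v) (allFin k)) ≤ D
    |dependent|≤D S v Sv = begin
      length (filterᵇ (dependent S v) (allFin k))   ≡⟨ length-filterᵇ-allFin (dependent S v) ⟩
      size (dependent S v)                          ≤⟨ size-mono dependent⊆dep ⟩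
      size (λ w → dep v w ∧ not (w == v))           ≤⟨ dep-degree v ⟩
      D                                             ∎
      where
      open ≤-Reasoning
      dependent⊆dep : ∀ w → dependent S v w ≡ true → (dep v w ∧ not (w == v)) ≡ true
      dependent⊆dep w Sw∧dep with w ≟ v
      ... | yes refl with () ← trans (sym (∧-conicalˡ (S v) _ Sw∧dep)) Sv
      ... | no _     = trans (∧-identityʳ (dep v w)) (∧-conicalʳ (S w) _ Sw∧dep)

    independent∪dependent : ∀ S v w → (independent S v w ∨ w ∈ᵇ filterᵇ (dependent S v) (allFin k)) ≡ S w
    independent∪dependent S v w rewrite ∈ᵇ-filterᵇ-allFin (dependent S v) w with S w | dep v w
    ... | true  | true  = refl
    ... | true  | false = refl
    ... | false | _     = refl

    -- Re-inserting the at most D dependent events of S one at a time,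
    -- each costs a factor at most D / (D + 1) by the induction hypothesis.
    #avoid-independent : ∀ S v → S v ≡ false →
      (∀ {T} → size T < size S → ∀ u → suc D * #avoid-hit T u ≤ #avoid T) →
      D ^ D * #avoid (independent S v) ≤ suc D ^ D * #avoid S
    #avoid-independent S v Sv IH = pow-ratio-mono (n≤1+n D) (|dependent|≤D S v Sv) (begin
      D ^ length us * #avoid (independent S v)                               ≤⟨ #avoid-chain D (independent S v) us smaller ⟩
      suc D ^ length us * #avoid (λ w → independent S v w ∨ w ∈ᵇ us)         ≡⟨ cong (suc D ^ length us *_) (#avoid-cong (independent∪dependent S v)) ⟩
      suc D ^ length us * #avoid S                                           ∎)
      where
      open ≤-Reasoning
      us = filterᵇ (dependent S v) (allFin k)
      smaller : ∀ T u → u ∈ᵇ us ≡ true → (∀ w → T w ≡ true → (independent S v w ∨ w ∈ᵇ us) ≡ true) →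
        T u ≡ false → suc D * #avoid-hit T u ≤ #avoid T
      smaller T u u∈ T⊆ Tu = IH (size-⊂ u (λ w Tw → trans (sym (independent∪dependent S v w)) (T⊆ w Tw)) Tu
        (∧-conicalˡ (S u) _ (trans (sym (∈ᵇ-filterᵇ-allFin (dependent S v) u)) u∈))) u

    conditional-bound-step : ∀ S → (∀ {T} → size T < size S → ∀ u → suc D * #avoid-hit T u ≤ #avoid T) →
      ∀ v → suc D * #avoid-hit S v ≤ #avoid S
    conditional-bound-step S IH v with S v in Sv
    ... | true rewrite #avoid-hit-member S v Sv | *-zeroʳ D = z≤n
    ... | false = local-lemma-arith D P (#avoid-hit-anti v (λ w → ∧-conicalˡ (S w) _))
                    (independent-bound (independent S v) v independent-avoids-dep)
                    (#avoid-independent S v Sv IH) P-large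
      where
      independent-avoids-dep : ∀ w → independent S v w ≡ true → dep v w ≡ false
      independent-avoids-dep w Sw∧¬dep with S w | dep v w
      ... | true | false = refl

    conditional-bound : ∀ S v → suc D * #avoid-hit S v ≤ #avoid S
    conditional-bound = All.wfRec (wellFounded size <-wellFounded) _
      (λ S → ∀ v → suc D * #avoid-hit S v ≤ #avoid S) conditional-bound-step

    symmetric-local-lemma : Σ (Vec Bool m) (λ x → Ω x ≡ true) →
      Σ (Vec Bool m) (λ x → Ω x ≡ true × ∀ v → A v x ≡ false)
    symmetric-local-lemma (x₀ , Ωx₀) =
      let x , Ωx∧avoid = 0<count⇒witness (λ x → Ω x ∧ avoids every x) 0<#avoid-every
      in x , ∧-conicalˡ (Ω x) _ Ωx∧avoid , λ v → avoids-elim (∧-conicalʳ (Ω x) _ Ωx∧avoid) v (∈ᵇ-allFin v)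
      where
      open ≤-Reasoning
      none every : Fin k → Bool
      none _  = false
      every w = false ∨ w ∈ᵇ allFin k
      j = length (allFin k)
      0<#avoid-none : 0 < #avoid none
      0<#avoid-none = witness⇒0<count _ x₀ (trans (cong (_∧ avoids none x₀) Ωx₀) (allᶠ-true {k}))
      0<#avoid-every : 0 < #avoid every
      0<#avoid-every = >-nonZero⁻¹ (#avoid every) {{m*n≢0⇒n≢0 (suc D ^ j) {{>-nonZero (begin-strict
        0                          <⟨ *-mono-≤ (m^n>0 D {{>-nonZero 0<D}} j) 0<#avoid-none ⟩
        D ^ j * #avoid none        ≤⟨ #avoid-chain D none (allFin k) (λ T u _ _ _ → conditional-bound T u) ⟩
        suc D ^ j * #avoid every   ∎)}}}}

-- Lonely vertices

disagree-all : ∀ {n} → List (Fin n) → Fin n → Vec Bool n → Bool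
disagree-all us v x = all (λ u → lookup x u xor lookup x v) us

disagree-all-toggle : ∀ {n} us (v u : Fin n) → u ∈ᵇ us ≡ false → u ≢ v → ∀ x →
  disagree-all us v (toggle u x) ≡ disagree-all us v x
disagree-all-toggle us v u u∉ u≢v x = all-cong-∈ us (λ y y∈ →
  cong₂ _xor_ (lookup∘updateAt′ y u (∈ᵇ-∉ᵇ⇒≢ us y∈ u∉) x) (lookup∘updateAt′ v u (u≢v ∘ sym) x))

count-disagree-all : ∀ {n} us v (F : Vec Bool n → Bool) → Nodup us → v ∈ᵇ us ≡ false →
  (∀ u → u ∈ᵇ us ≡ true → ∀ x → F (toggle u x) ≡ F x) →
  2 ^ length us * count (λ x → F x ∧ disagree-all us v x) ≡ count F
count-disagree-all []       v F _ _ _ = trans (+-identityʳ _) (count-cong (λ x → ∧-identityʳ (F x)))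
count-disagree-all (u ∷ us) v F (u∉us , nodup) v∉ F-inv = begin
  2 * 2 ^ j * count (λ x → F x ∧ ((lookup x u xor lookup x v) ∧ disagree-all us v x))
    ≡⟨ cong (2 * 2 ^ j *_) (count-cong (λ x → ∧-Comm.x∙yz≈xz∙y (F x) _ (disagree-all us v x))) ⟩
  2 * 2 ^ j * count (λ x → G x ∧ (lookup x u xor lookup x v))
    ≡⟨ *-Comm.xy∙z≈y∙xz 2 (2 ^ j) _ ⟩
  2 ^ j * (2 * count (λ x → G x ∧ (lookup x u xor lookup x v)))
    ≡⟨ cong (2 ^ j *_) (count-halves u G (λ x → lookup x v) G-inv (lookup∘updateAt′ v u v≢u)) ⟩
  2 ^ j * count G
    ≡⟨ count-disagree-all us v F nodup v∉us (λ y y∈ → F-inv y (∈ᵇ-there y u us y∈)) ⟩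
  count F
    ∎
  where
  open ≡-Reasoning
  j = length us
  v≢u = proj₁ (∉ᵇ-∷⁻ v u us v∉)
  v∉us = proj₂ (∉ᵇ-∷⁻ v u us v∉)
  G : Vec Bool _ → Bool
  G x = F x ∧ disagree-all us v x
  G-inv : ∀ x → G (toggle u x) ≡ G x
  G-inv x = cong₂ _∧_ (F-inv u (∈ᵇ-here u us) x) (disagree-all-toggle us v u u∉us (v≢u ∘ sym) x)

separated : ∀ {n} → Fin n → Fin n → Vec Bool n → Bool
separated v₁ v₂ x = lookup x v₁ ∧ not (lookup x v₂)

lonely : ∀ {n} → (Fin n → List (Fin n)) → Fin n → Vec Bool n → Bool
lonely L v = disagree-all (L v) v

-- lonely L v is determined by the colours of v and of L v; shares L v w
-- holds when toggling a colour in L v may change lonely L w.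
shares : ∀ {n} → (Fin n → List (Fin n)) → Fin n → Fin n → Bool
shares L v w = any (λ u → (u == w) ∨ (u ∈ᵇ L w)) (L v)

module _ {n : ℕ} (L : Fin n → List (Fin n)) (v₁ v₂ : Fin n) where

  open LocalLemma (separated v₁ v₂) (lonely L)

  separated-toggle : ∀ u → u ≢ v₁ → u ≢ v₂ → ∀ x → separated v₁ v₂ (toggle u x) ≡ separated v₁ v₂ x
  separated-toggle u u≢v₁ u≢v₂ x =
    cong₂ (λ a b → a ∧ not b) (lookup∘updateAt′ v₁ u (u≢v₁ ∘ sym) x) (lookup∘updateAt′ v₂ u (u≢v₂ ∘ sym) x)

  -- The colours on L v ∖ {a} are constrained neither by separated nor by the
  -- events of S, so each of them halves the count.
  lonely-bound-excluding : ∀ d S v a → Nodup (L v) → v ∈ᵇ L v ≡ false → d ≤ length (L v) →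
    (∀ w → S w ≡ true → shares L v w ≡ false) →
    (∀ u → u ∈ᵇ L v ≡ true → u ≢ a → u ≢ v₁ × u ≢ v₂) →
    2 ^ (d ∸ 1) * #avoid-hit S v ≤ #avoid S
  lonely-bound-excluding d S v a nodup v∉ d≤|L| S-indep unseparating = begin
    2 ^ (d ∸ 1) * #avoid-hit S v
      ≤⟨ *-mono-≤ (^-monoʳ-≤ 2 d∸1≤|U|) (count-mono lonely⇒disagree) ⟩
    2 ^ length U * count (λ x → F x ∧ disagree-all U v x)
      ≡⟨ count-disagree-all U v F (Nodup-filterᵇ _ (L v) nodup) v∉U F-inv ⟩
    #avoid S
      ∎
    where
    open ≤-Reasoning
    U = filterᵇ (λ u → not (u == a)) (L v)
    F : Vec Bool n → Bool
    F x = separated v₁ v₂ x ∧ avoids S x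
    d∸1≤|U| : d ∸ 1 ≤ length U
    d∸1≤|U| = ∸-monoˡ-≤ 1 (≤-trans d≤|L| (length≤1+length-filterᵇ-≢ a (L v) nodup))
    lonely⇒disagree : ∀ x → (F x ∧ lonely L v x) ≡ true → (F x ∧ disagree-all U v x) ≡ true
    lonely⇒disagree x hit with F x | lonely L v x in lonely-v
    ... | true | true = all-filterᵇ _ _ (L v) lonely-v
    v∉U : v ∈ᵇ U ≡ false
    v∉U = trans (∈ᵇ-filterᵇ _ v (L v)) (trans (cong (_ ∧_) v∉) (∧-zeroʳ _))
    F-inv : ∀ u → u ∈ᵇ U ≡ true → ∀ x → F (toggle u x) ≡ F x
    F-inv u u∈U x = cong₂ _∧_ (separated-toggle u (proj₁ u≢v₁₂) (proj₂ u≢v₁₂) x)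
      (avoids-resp (toggle u) x (λ w Sw → disagree-all-toggle (L w) w u (u∉L w Sw) (u≢ w Sw) x))
      where
      u∈L = proj₁ (∈ᵇ-filterᵇ-≢⁻ a u (L v) u∈U)
      u≢v₁₂ = unseparating u u∈L (proj₂ (∈ᵇ-filterᵇ-≢⁻ a u (L v) u∈U))
      unshared : ∀ w → S w ≡ true → ((u == w) ∨ (u ∈ᵇ L w)) ≡ false
      unshared w Sw = any-false-elim _ (L v) (S-indep w Sw) u u∈L
      u∉L : ∀ w → S w ≡ true → u ∈ᵇ L w ≡ false
      u∉L w Sw = ∨-conicalʳ (u == w) _ (unshared w Sw)
      u≢ : ∀ w → S w ≡ true → u ≢ w
      u≢ w Sw refl with () ← trans (sym (==-refl u)) (∨-conicalˡ (u == u) _ (unshared u Sw))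

  separated⇒¬lonely : ∀ v → v₁ ∈ᵇ L v ≡ true → v₂ ∈ᵇ L v ≡ true → ∀ x → separated v₁ v₂ x ≡ true → lonely L v x ≢ true
  separated⇒¬lonely v v₁∈ v₂∈ x sep lonely-v
    with all-elim _ (L v) lonely-v v₁ v₁∈ | all-elim _ (L v) lonely-v v₂ v₂∈
  ... | v₁≠v | v₂≠v with lookup x v₁ | lookup x v₂ | lookup x v
  ...   | true | false | true  with () ← v₁≠v
  ...   | true | false | false with () ← v₂≠v

  lonely-bound : ∀ d S v → Nodup (L v) → v ∈ᵇ L v ≡ false → d ≤ length (L v) →
    (∀ w → S w ≡ true → shares L v w ≡ false) → 2 ^ (d ∸ 1) * #avoid-hit S v ≤ #avoid S
  lonely-bound d S v nodup v∉ d≤|L| S-indep with v₁ ∈ᵇ L v in v₁∈ | v₂ ∈ᵇ L v in v₂∈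
  ... | true | true = ≤-trans (≤-reflexive (trans (cong (2 ^ (d ∸ 1) *_) hit≡0) (*-zeroʳ (2 ^ (d ∸ 1))))) z≤n
    where
    hit≡0 : #avoid-hit S v ≡ 0
    hit≡0 = count-never _ λ x hit → separated⇒¬lonely v v₁∈ v₂∈ x
      (∧-conicalˡ (separated v₁ v₂ x) _ (∧-conicalˡ _ (lonely L v x) hit)) (∧-conicalʳ _ (lonely L v x) hit)
  ... | false | _ = lonely-bound-excluding d S v v₂ nodup v∉ d≤|L| S-indep
                      (λ u u∈ u≢v₂ → ∈ᵇ-∉ᵇ⇒≢ (L v) u∈ v₁∈ , u≢v₂)
  ... | true | false = lonely-bound-excluding d S v v₁ nodup v∉ d≤|L| S-indep
                      (λ u u∈ u≢v₁ → u≢v₁ , ∈ᵇ-∉ᵇ⇒≢ (L v) u∈ v₂∈)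

out-list : ∀ {n} → Digraph n → ℕ → Fin n → List (Fin n)
out-list {n} G d v = take d (filterᵇ (arc G v) (allFin n))

module _ {n : ℕ} (G : Digraph n) (d : ℕ) where

  out-list-arc : ∀ v u → u ∈ᵇ out-list G d v ≡ true → arc G v u ≡ true
  out-list-arc v u u∈ = trans (sym (∈ᵇ-filterᵇ-allFin (arc G v) u)) (∈ᵇ-take d _ u u∈)

  out-list-Nodup : ∀ v → Nodup (out-list G d v)
  out-list-Nodup v = Nodup-take d _ (Nodup-filterᵇ (arc G v) _ (Nodup-allFin n))

  out-list-irrefl : ∀ v → v ∈ᵇ out-list G d v ≡ false
  out-list-irrefl v with v ∈ᵇ out-list G d v in v∈
  ... | false = refl
  ... | true with () ← trans (sym (out-list-arc v v v∈)) (noLoop G v)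

  out-list-length : ∀ v → d ≤ outdeg G v → length (out-list G d v) ≡ d
  out-list-length v d≤ = trans (length-take d _) (m≤n⇒m⊓n≡m d≤)

  shares-degree : ∀ δ → (∀ v → d ≤ outdeg G v) → (∀ v → indeg G v ≤ δ) →
    ∀ v → size (λ w → shares (out-list G d) v w ∧ not (w == v)) ≤ d * δ
  shares-degree δ out≥d in≤δ v = begin
    size (λ w → shares L v w ∧ not (w == v))   ≤⟨ size-mono shared⇒via ⟩
    size (λ w → any (λ u → via u w) (L v))      ≤⟨ size-any≤length* via (L v) δ |via|≤δ ⟩
    length (L v) * δ                            ≡⟨ cong (_* δ) (out-list-length v (out≥d v)) ⟩
    d * δ                                       ∎
    where
    open ≤-Reasoning
    L = out-list G d
    -- w ≠ v shares the variable u ∈ L v with v only if w = u or w → u is an arc other than v → u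
    via : Fin n → Fin n → Bool
    via u w = (w == u) ∨ (arc G w u ∧ not (w == v))
    |via|≤δ : ∀ u → u ∈ᵇ L v ≡ true → size (via u) ≤ δ
    |via|≤δ u u∈ = begin
      size (via u)                                                   ≤⟨ size-∨ (_== u) _ ⟩
      size (_== u) + size (λ w → arc G w u ∧ not (w == v))           ≡⟨ cong (_+ size (λ w → arc G w u ∧ not (w == v))) (size-singleton u) ⟩
      1 + size (λ w → arc G w u ∧ not (w == v))                      ≤⟨ +-monoˡ-≤ _ (member⇒0<size _ v v→u) ⟩
      size (λ w → arc G w u ∧ (w == v)) + size (λ w → arc G w u ∧ not (w == v)) ≡⟨ size-split (λ w → arc G w u) (_== v) ⟨
      size (λ w → arc G w u)                                         ≡⟨ length-filterᵇ-allFin (λ w → arc G w u) ⟨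
      indeg G u                                                      ≤⟨ in≤δ u ⟩
      δ                                                              ∎
      where
      v→u : (arc G v u ∧ (v == v)) ≡ true
      v→u rewrite out-list-arc v u u∈ = ==-refl v
    shared⇒via : ∀ w → (shares L v w ∧ not (w == v)) ≡ true → any (λ u → via u w) (L v) ≡ true
    shared⇒via w shared = any-mono-∈ (L v) u⇒via (∧-conicalˡ (shares L v w) _ shared)
      where
      u⇒via : ∀ u → u ∈ᵇ L v ≡ true → ((u == w) ∨ (u ∈ᵇ L w)) ≡ true → via u w ≡ true
      u⇒via u _ u-shared with w ≟ u
      ... | yes _ = refl
      ... | no w≢u = trans (cong (_∧ not (w == v)) (out-list-arc w u u∈Lw)) (∧-conicalʳ (shares L v w) _ shared)
        where
        u∈Lw : u ∈ᵇ L w ≡ true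
        u∈Lw = trans (sym (cong (_∨ u ∈ᵇ L w) (dec-false (u ≟ w) (w≢u ∘ sym)))) u-shared

separated-witness : ∀ {n} {v₁ v₂ : Fin n} → v₁ ≢ v₂ → Σ (Vec Bool n) (λ x → separated v₁ v₂ x ≡ true)
separated-witness {v₁ = v₁} {v₂} v₁≢v₂ = x₀ , (begin
  lookup x₀ v₁ ∧ not (lookup x₀ v₂)    ≡⟨ cong₂ (λ a b → a ∧ not b) (lookup∘tabulate (_== v₁) v₁) (lookup∘tabulate (_== v₁) v₂) ⟩
  (v₁ == v₁) ∧ not (v₂ == v₁)          ≡⟨ cong₂ (λ a b → a ∧ not b) (==-refl v₁) (dec-false (v₂ ≟ v₁) (v₁≢v₂ ∘ sym)) ⟩
  true                                 ∎)
  where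
  open ≡-Reasoning
  x₀ = tabulateᵛ (_== v₁)

xor≡false⇒≡ : ∀ a b → (a xor b) ≡ false → a ≡ b
xor≡false⇒≡ true  true  _ = refl
xor≡false⇒≡ false false _ = refl

friendly-colouring : ∀ {n} (G : Digraph n) (L : Fin n → List (Fin n)) →
  (∀ v u → u ∈ᵇ L v ≡ true → arc G v u ≡ true) → ∀ {v₁ v₂} x →
  separated v₁ v₂ x ≡ true → (∀ v → lonely L v x ≡ false) →
  IsFriendly G (lookup x) × Separates (lookup x) v₁ v₂
friendly-colouring G L L⊆arc {v₁} {v₂} x sep ¬lonely =
  ((v₁ , x₁≡true) , (v₂ , x₂≡false) , friend) , λ x₁≡x₂ → case trans (sym x₁≡true) (trans x₁≡x₂ x₂≡false) of λ ()
  where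
  x₁≡true = ∧-conicalˡ (lookup x v₁) _ sep
  x₂≡false = not-injective (∧-conicalʳ (lookup x v₁) _ sep)
  friend : ∀ v → Σ (Fin _) (λ u → arc G v u ≡ true × lookup x u ≡ lookup x v)
  friend v with all-false⇒witness _ (L v) (¬lonely v)
  ... | u , u∈ , same = u , L⊆arc v u u∈ , xor≡false⇒≡ _ _ same

0<outdeg⇒0<indeg-bound : ∀ {n} (G : Digraph n) {δ} → (∀ v → indeg G v ≤ δ) → ∀ v → 0 < outdeg G v → 0 < δ
0<outdeg⇒0<indeg-bound {n} G in≤δ v 0<out =
  let u , v→u = 0<size⇒member (arc G v) (subst (0 <_) (length-filterᵇ-allFin (arc G v)) 0<out)
  in ≤-trans (subst (0 <_) (sym (length-filterᵇ-allFin (λ w → arc G w u))) (member⇒0<size _ v v→u)) (in≤δ u)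

open LocalLemma using (symmetric-local-lemma)

theorem1p10 : (n d δ : ℕ) → 1 ≤ d → (G : Digraph n) →
    (∀ v → d ≤ outdeg G v) → (∀ v → indeg G v ≤ δ) →
    e* (d * δ + 1) ≤ (2 ^ (d ∸ 1)) →
    (v₁ v₂ : Fin n) → v₁ ≢ v₂ →
    Σ (Fin n → Bool) (λ part → IsFriendly G part × Separates part v₁ v₂)
theorem1p10 n d δ 1≤d G out≥d in≤δ e-bound v₁ v₂ v₁≢v₂ =
  let x , sep , ¬lonely = colouring in lookup x , friendly-colouring G L (out-list-arc G d) x sep ¬lonely
  where
  L = out-list G d
  0<dδ : 0 < d * δ
  0<dδ = *-mono-≤ 1≤d (0<outdeg⇒0<indeg-bound G in≤δ v₁ (≤-trans 1≤d (out≥d v₁)))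
  colouring : Σ (Vec Bool n) (λ x → separated v₁ v₂ x ≡ true × ∀ v → lonely L v x ≡ false)
  colouring = symmetric-local-lemma (separated v₁ v₂) (lonely L) (shares L) (d * δ) (2 ^ (d ∸ 1)) 0<dδ
    (shares-degree G d δ out≥d in≤δ)
    (λ S v → lonely-bound L v₁ v₂ d S v (out-list-Nodup G d v) (out-list-irrefl G d v)
               (≤-reflexive (sym (out-list-length G d v (out≥d v)))))
    (e*≤⇒[1+D]^[1+D]≤*^ (d * δ) (2 ^ (d ∸ 1)) (subst (λ m → e* m ≤ (2 ^ (d ∸ 1))) (+-comm (d * δ) 1) e-bound))
    (separated-witness v₁≢v₂)
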